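{- Let $G$ be a finite simple graph of order $p$ without isolated vertices and with $p-2\ge\delta(G)\ge1$. If there is a $d$-sequence $\{\mathcal G_i\}_{i=1}^s$ of $G$ such that $z_i(G)=\sum_{j=2}^i y_j(G)\ge 0$ for all $2\le i\le s$, then $str(G)\le p+d_G$. Moreover, equality holds if $d_G=\delta(G)$.
   Context: For a graph $G$ of order $p$, a numbering is a bijection $f:V(G)\to\{1,\dots,p\}$; $str_f(G)=\max\{f(u)+f(v): uv\in E(G)\}$ and $str(G)=\min\{str_f(G)\}$ over numberings. $\delta(\cdot)$ is minimum degree, $+$ is disjoint union, $mK_1$ is $m$ isolated vertices, $K_r$ is the complete graph. Empty sums are $0$. $d$-sequence: Set $\mathcal G_1=G_1=G$, $m_1=0$. For $i\ge1$, if $\mathcal G_i$ is neither of the form $mK_1$ ($m\ge1$) nor $mK_1+K_r$ ($m\ge0$, $r\ge2$), write $\mathcal G_i=m_iK_1+G_i$ where $m_i\ge0$ is the number of isolated vertices of $\mathcal G_i$ and $G_i$ has no isolated vertices; choose any vertex $u_i$ of $G_i$, let $d_i$ be its degree in $G_i$, and let $\mathcal G_{i+1}$ be obtained from $\mathcal G_i$ by deleting its isolated vertices, $u_i$, and all neighbors of $u_i$. Stop at the first $s$ with $\mathcal G_s=m_sK_1$, $m_s\ge1$ (set $d_s=0$) or $\mathcal G_s=m_sK_1+K_r$, $m_s\ge0$, $r\ge2$ (set $d_s=r-1$). Write $d_G=d_1$, $y_j(G)=m_j+1-d_j$ for $1\le j\le s$. -}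

module Defs where

open import Data.Nat using (ℕ; zero; suc; _+_; _∸_; _≤_; _⊔_; _⊓_; _≡ᵇ_)
open import Data.Bool using (Bool; true; false; _∧_; not; if_then_else_)
open import Data.Fin using (Fin; toℕ; _≟_)
open import Data.Fin.Permutation using (Permutation′; _⟨$⟩ʳ_)
open import Data.List using (List; []; _∷_; foldr; allFin; length; take)
open import Data.Integer as ℤ using (ℤ; +_)
open import Data.Product using (Σ; ∃; _×_)
open import Relation.Nullary using (¬_; does)
open import Relation.Binary.PropositionalEquality using (_≡_; _≢_)

record Graph (p : ℕ) : Set where
  field
    adj    : Fin p → Fin p → Bool
    sym    : ∀ u v → adj u v ≡ adj v u
    irrefl : ∀ u → adj u u ≡ false
open Graph public

module _ {p : ℕ} (G : Graph p) where

  -- vertex subsets (an induced subgraph of G is given by its vertex subset)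
  VSet : Set
  VSet = Fin p → Bool

  count : (Fin p → Bool) → ℕ
  count P = foldr (λ x acc → (if P x then 1 else 0) + acc) 0 (allFin p)

  maxOver : (Fin p → ℕ) → ℕ
  maxOver f = foldr (λ x acc → f x ⊔ acc) 0 (allFin p)

  full : VSet
  full _ = true

  degIn : VSet → Fin p → ℕ
  degIn S v = count (λ w → S w ∧ adj G v w)

  deg : Fin p → ℕ
  deg = degIn full

  -- minimum degree δ(G)  (degrees are < p, so the initial value p is harmless for p ≥ 1)
  δ : ℕ
  δ = foldr (λ x acc → deg x ⊓ acc) p (allFin p)

  isIso : VSet → Fin p → Bool
  isIso S v = S v ∧ (degIn S v ≡ᵇ 0)

  isNonIso : VSet → Fin p → Bool
  isNonIso S v = S v ∧ not (degIn S v ≡ᵇ 0)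

  nIso : VSet → ℕ
  nIso S = count (isIso S)

  nNonIso : VSet → ℕ
  nNonIso S = count (isNonIso S)

  IsEmptyForm : VSet → Set
  IsEmptyForm S = (∃ λ v → S v ≡ true) × (∀ v → S v ≡ true → degIn S v ≡ 0)

  -- G[S] ≅ m K₁ + K_r with m ≥ 0, r ≥ 2 : the non-isolated vertices exist
  -- and are pairwise adjacent (a non-isolated vertex has a neighbour, so r ≥ 2)
  IsCliqueForm : VSet → Set
  IsCliqueForm S = (∃ λ v → isNonIso S v ≡ true)
                 × (∀ u v → isNonIso S u ≡ true → isNonIso S v ≡ true → u ≢ v → adj G u v ≡ true)

  Terminal : VSet → Set
  Terminal S = IsEmptyForm S Data.Sum.⊎ IsCliqueForm S
    where import Data.Sum

  next : VSet → Fin p → VSet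
  next S u w = S w ∧ not (degIn S w ≡ᵇ 0) ∧ not (does (u ≟ w)) ∧ not (adj G u w)

  data DSeq (S : VSet) : Set where
    stop : Terminal S → DSeq S
    step : ¬ Terminal S → (u : Fin p) → S u ≡ true → 1 ≤ degIn S u
         → DSeq (next S u) → DSeq S

  -- d of the current graph of a d-sequence: d_i = deg(u_i), or d_s = r - 1 (0 if mK₁)
  dHead : ∀ {S} → DSeq S → ℕ
  dHead {S} (stop _) = nNonIso S ∸ 1
  dHead {S} (step _ u _ _ _) = degIn S u

  y : ℕ → ℕ → ℤ
  y m d = (+ m ℤ.+ + 1) ℤ.- + d

  ys : ∀ {S} → DSeq S → List ℤ
  ys {S} D@(stop _) = y (nIso S) (dHead D) ∷ []
  ys {S} D@(step _ _ _ _ D') = y (nIso S) (dHead D) ∷ ys D'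

  dG : DSeq full → ℕ
  dG = dHead

  lab : Permutation′ p → Fin p → ℕ
  lab f u = suc (toℕ (f ⟨$⟩ʳ u))

  strf : Permutation′ p → ℕ
  strf f = maxOver (λ u → maxOver (λ v → if adj G u v then lab f u + lab f v else 0))

  IsStr : ℕ → Set
  IsStr k = (∃ λ f → strf f ≡ k) × (∀ f → k ≤ strf f)

sumℤ : List ℤ → ℤ
sumℤ = foldr ℤ._+_ (+ 0)

-- z_i = Σ_{j=2}^i y_j ≥ 0 for all 2 ≤ i ≤ s, given the list ys = y_1 … y_s
ZNonneg : List ℤ → Set
ZNonneg [] = Data.Unit.⊤
  where import Data.Unit
ZNonneg (_ ∷ t) = ∀ k → 1 ≤ k → k ≤ length t → + 0 ℤ.≤ sumℤ (take k t)

-- Upper bound: number the vertices along the d-sequence. When u_i is removed, its d_i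
-- neighbours take the smallest free labels, while u_i and the m_i isolated vertices of 𝒢_i take
-- the largest ones; in the terminal graph the clique takes the smallest free labels and the
-- isolated vertices the largest. An edge disappears at the first step deleting one of its ends;
-- then one end x is a neighbour of u_i (or the smaller end inside the terminal clique), so
-- f(x) ≤ d_1 + … + d_i, while the other end y lies below the high labels of u_1, …, u_{i−1} and
-- of the isolated vertices of 𝒢_1, …, 𝒢_i, so f(y) ≤ p − (m_1 + 1) − … − (m_{i−1} + 1) − m_i.
-- Hence f(x) + f(y) ≤ p + d_G amounts to m_1 + z_i ≥ 0. The numbering ranks the vertices by
-- their block, ties broken by index. Lower bound: the vertex labelled p has at least δ(G)
-- neighbours, with distinct labels, so one of them is labelled at least δ(G).

module Submission where

open import Defs hiding (sym)
open import Data.Nat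
  using ( ℕ; zero; suc; pred; _+_; _∸_; _*_; _≤_; _<_; _≥_; _≤?_; _<?_; _≟_; _⊔_; _⊓_; _≡ᵇ_
        ; z≤n; s≤s; s≤s⁻¹)
open import Data.Nat.Properties hiding (suc-injective; _≟_)
open import Data.Bool using (Bool; true; false; _∧_; _∨_; not; if_then_else_)
import Data.Bool.Properties as Bool
open import Data.Fin using (Fin; zero; suc; toℕ; fromℕ; fromℕ<; punchIn; punchOut)
open import Data.Fin.Properties
  using (any?; suc-injective; toℕ-injective; toℕ<n; toℕ-fromℕ; toℕ-fromℕ<; punchOut-injective; injective⇒≤)
  renaming (_≟_ to _≟ᶠ_)
open import Data.Fin.Permutation
  using ( Permutation′; _⟨$⟩ʳ_; _⟨$⟩ˡ_; _≈_; permutation; inverseˡ; inverseʳ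
        ; insert; remove; insert-punchIn; insert-remove)
  renaming (id to idₚ)
open import Data.Integer as ℤ using (ℤ; +_)
import Data.Integer.Properties as ℤ
open import Data.Integer.Tactic.RingSolver using (solve-∀)
open import Data.List using ([]; _∷_; foldr; tabulate; allFin; length; take)
open import Data.List.Membership.Propositional using (_∈_)
open import Data.List.Membership.Propositional.Properties using (∈-allFin)
open import Data.List.Relation.Unary.Any using (here; there)
open import Data.Product using (∃; _×_; _,_; proj₁; proj₂)
open import Data.Sum using (_⊎_; inj₁; inj₂)
open import Data.Empty using (⊥; ⊥-elim)
open import Function using (id; _∘_; _∘₂_)
open import Relation.Binary.Definitions using (tri<; tri≈; tri>)
open import Relation.Binary.PropositionalEquality
  using (_≡_; _≢_; refl; sym; trans; cong; cong₂; subst; subst₂; module ≡-Reasoning)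
open import Relation.Nullary using (¬_; Dec; yes; no; does)
open import Relation.Nullary.Decidable using (dec-true; dec-false; _×-dec_)
import Relation.Nullary.Decidable as Dec
open import Relation.Nullary.Negation using (contradiction)

-- Counting Boolean predicates on Fin n

private
  variable
    n : ℕ

witness : ∀ {A : Set} (a? : Dec A) → does a? ≡ true → A
witness (yes a) _ = a

if-false : ∀ {A : Set} {b} {a a′ : A} → b ≡ false → (if b then a else a′) ≡ a′
if-false refl = refl

positive⇒≢ᵇ0 : 0 < n → (n ≡ᵇ 0) ≡ false
positive⇒≢ᵇ0 (s≤s _) = refl

∣_∣ : (Fin n → Bool) → ℕ
∣_∣ {zero} P = 0
∣_∣ {suc n} P = (if P zero then 1 else 0) + ∣ P ∘ suc ∣

_⊆_ : (Fin n → Bool) → (Fin n → Bool) → Set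
P ⊆ Q = ∀ {i} → P i ≡ true → Q i ≡ true

_∪_ : (Fin n → Bool) → (Fin n → Bool) → Fin n → Bool
(P ∪ Q) i = P i ∨ Q i

⁅_⁆ : Fin n → Fin n → Bool
⁅ i ⁆ j = does (j ≟ᶠ i)

Disjoint : (Fin n → Bool) → (Fin n → Bool) → Set
Disjoint P Q = ∀ {i} → P i ≡ true → Q i ≡ true → ⊥

foldr-count-tabulate : ∀ {m} (P : Fin m → Bool) (g : Fin n → Fin m) →
  foldr (λ x acc → (if P x then 1 else 0) + acc) 0 (tabulate g) ≡ ∣ P ∘ g ∣
foldr-count-tabulate {zero}  P g = refl
foldr-count-tabulate {suc n} P g = cong (λ c → _ + c) (foldr-count-tabulate P (g ∘ suc))

∣P∣≤n : (P : Fin n → Bool) → ∣ P ∣ ≤ n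
∣P∣≤n {zero}  P = z≤n
∣P∣≤n {suc n} P with P zero
... | true  = s≤s (∣P∣≤n (P ∘ suc))
... | false = m≤n⇒m≤1+n (∣P∣≤n (P ∘ suc))

P⊆Q⇒∣P∣≤∣Q∣ : {P Q : Fin n → Bool} → P ⊆ Q → ∣ P ∣ ≤ ∣ Q ∣
P⊆Q⇒∣P∣≤∣Q∣ {zero}          P⊆Q = z≤n
P⊆Q⇒∣P∣≤∣Q∣ {suc n} {P} {Q} P⊆Q with P zero in P₀ | Q zero in Q₀
... | true  | true  = s≤s (P⊆Q⇒∣P∣≤∣Q∣ {P = P ∘ suc} {Q ∘ suc} P⊆Q)
... | false | true  = m≤n⇒m≤1+n (P⊆Q⇒∣P∣≤∣Q∣ {P = P ∘ suc} {Q ∘ suc} P⊆Q)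
... | false | false = P⊆Q⇒∣P∣≤∣Q∣ {P = P ∘ suc} {Q ∘ suc} P⊆Q
... | true  | false with () ← trans (sym (P⊆Q P₀)) Q₀

∣P∪Q∣≤∣P∣+∣Q∣ : (P Q : Fin n → Bool) → ∣ P ∪ Q ∣ ≤ ∣ P ∣ + ∣ Q ∣
∣P∪Q∣≤∣P∣+∣Q∣ {zero}  P Q = z≤n
∣P∪Q∣≤∣P∣+∣Q∣ {suc n} P Q with P zero | Q zero
... | true  | true  = s≤s (≤-trans (∣P∪Q∣≤∣P∣+∣Q∣ (P ∘ suc) (Q ∘ suc)) (+-monoʳ-≤ _ (n≤1+n _)))
... | true  | false = s≤s (∣P∪Q∣≤∣P∣+∣Q∣ (P ∘ suc) (Q ∘ suc))
... | false | true  = ≤-trans (s≤s (∣P∪Q∣≤∣P∣+∣Q∣ (P ∘ suc) (Q ∘ suc))) (≤-reflexive (sym (+-suc _ _)))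
... | false | false = ∣P∪Q∣≤∣P∣+∣Q∣ (P ∘ suc) (Q ∘ suc)

Disjoint⇒∣P∣+∣Q∣≤∣P∪Q∣ : {P Q : Fin n → Bool} → Disjoint P Q → ∣ P ∣ + ∣ Q ∣ ≤ ∣ P ∪ Q ∣
Disjoint⇒∣P∣+∣Q∣≤∣P∪Q∣ {zero}          _    = z≤n
Disjoint⇒∣P∣+∣Q∣≤∣P∪Q∣ {suc n} {P} {Q} P#Q with P zero in P₀ | Q zero in Q₀
... | true  | true  = ⊥-elim (P#Q P₀ Q₀)
... | true  | false = s≤s (Disjoint⇒∣P∣+∣Q∣≤∣P∪Q∣ {P = P ∘ suc} {Q ∘ suc} P#Q)
... | false | true  =
  ≤-trans (≤-reflexive (+-suc _ _)) (s≤s (Disjoint⇒∣P∣+∣Q∣≤∣P∪Q∣ {P = P ∘ suc} {Q ∘ suc} P#Q))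
... | false | false = Disjoint⇒∣P∣+∣Q∣≤∣P∪Q∣ {P = P ∘ suc} {Q ∘ suc} P#Q

∈⇒0<∣P∣ : (P : Fin n → Bool) {i : Fin n} → P i ≡ true → 0 < ∣ P ∣
∈⇒0<∣P∣ P {zero} Pi rewrite Pi = s≤s z≤n
∈⇒0<∣P∣ P {suc i} Pi = <-≤-trans (∈⇒0<∣P∣ (P ∘ suc) Pi) (m≤n+m _ _)

∅⇒∣P∣≡0 : (P : Fin n → Bool) → (∀ i → P i ≡ false) → ∣ P ∣ ≡ 0
∅⇒∣P∣≡0 {zero}  P ∅ = refl
∅⇒∣P∣≡0 {suc n} P ∅ rewrite ∅ zero = ∅⇒∣P∣≡0 (P ∘ suc) (∅ ∘ suc)

subsingleton⇒∣P∣≤1 : (P : Fin n → Bool) → (∀ {i j} → P i ≡ true → P j ≡ true → i ≡ j) → ∣ P ∣ ≤ 1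
subsingleton⇒∣P∣≤1 {zero}  P _ = z≤n
subsingleton⇒∣P∣≤1 {suc n} P unique with P zero in P₀
... | true  = ≤-reflexive (cong suc (∅⇒∣P∣≡0 (P ∘ suc) only-zero))
  where
  only-zero : ∀ i → P (suc i) ≡ false
  only-zero i with P (suc i) in Pᵢ
  ... | false = refl
  ... | true with () ← unique P₀ Pᵢ
... | false = subsingleton⇒∣P∣≤1 (P ∘ suc) (suc-injective ∘₂ unique)

∪-introˡ : (P Q : Fin n → Bool) {i : Fin n} → P i ≡ true → (P ∪ Q) i ≡ true
∪-introˡ P Q Pi = cong (_∨ Q _) Pi

∪-introʳ : (P Q : Fin n → Bool) {i : Fin n} → Q i ≡ true → (P ∪ Q) i ≡ true
∪-introʳ P Q Qi = trans (cong (P _ ∨_) Qi) (Bool.∨-zeroʳ (P _))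

∪-elim : (P Q : Fin n → Bool) {i : Fin n} → (P ∪ Q) i ≡ true → P i ≡ true ⊎ Q i ≡ true
∪-elim P Q {i} h with P i
... | true  = inj₁ refl
... | false = inj₂ h

P⊆Q∖⁅i⁆⇒∣P∣<∣Q∣ : {P Q : Fin n → Bool} {i : Fin n} →
                  P ⊆ Q → P i ≡ false → Q i ≡ true → ∣ P ∣ < ∣ Q ∣
P⊆Q∖⁅i⁆⇒∣P∣<∣Q∣ {P = P} {Q} {i} P⊆Q Pi Qi = begin-strict
  ∣ P ∣               <⟨ m<m+n ∣ P ∣ (∈⇒0<∣P∣ ⁅ i ⁆ {i} (dec-true (i ≟ᶠ i) refl)) ⟩
  ∣ P ∣ + ∣ ⁅ i ⁆ ∣   ≤⟨ Disjoint⇒∣P∣+∣Q∣≤∣P∪Q∣ {P = P} {⁅ i ⁆} P#i ⟩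
  ∣ P ∪ ⁅ i ⁆ ∣       ≤⟨ P⊆Q⇒∣P∣≤∣Q∣ {P = P ∪ ⁅ i ⁆} P∪i⊆Q ⟩
  ∣ Q ∣               ∎
  where
  open ≤-Reasoning
  P#i : Disjoint P ⁅ i ⁆
  P#i {j} Pj j≡i with refl ← witness (j ≟ᶠ i) j≡i with () ← trans (sym Pj) Pi
  P∪i⊆Q : (P ∪ ⁅ i ⁆) ⊆ Q
  P∪i⊆Q {j} h with P j in Pj | ⁅ i ⁆ j in j≡i
  ... | true  | _    = P⊆Q Pj
  ... | false | true with refl ← witness (j ≟ᶠ i) j≡i = Qi

module _ {A : Set} (f : A → ℕ) where

  foldr-⊔-upperBound : ∀ {x xs} → x ∈ xs → f x ≤ foldr (λ y acc → f y ⊔ acc) 0 xs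
  foldr-⊔-upperBound (here refl) = m≤m⊔n _ _
  foldr-⊔-upperBound (there x∈xs) = ≤-trans (foldr-⊔-upperBound x∈xs) (m≤n⊔m _ _)

  foldr-⊔-least : ∀ {b} xs → (∀ x → f x ≤ b) → foldr (λ y acc → f y ⊔ acc) 0 xs ≤ b
  foldr-⊔-least [] _ = z≤n
  foldr-⊔-least (x ∷ xs) f≤b = ⊔-lub (f≤b x) (foldr-⊔-least xs f≤b)

  foldr-⊓-lowerBound : ∀ {e x xs} → x ∈ xs → foldr (λ y acc → f y ⊓ acc) e xs ≤ f x
  foldr-⊓-lowerBound (here refl) = m⊓n≤m _ _
  foldr-⊓-lowerBound (there x∈xs) = ≤-trans (m⊓n≤n _ _) (foldr-⊓-lowerBound x∈xs)

injective⇒∣f<c∣≤c : ∀ {m} (f : Fin n → Fin m) → (∀ {i j} → f i ≡ f j → i ≡ j) →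
                    ∀ c → ∣ (λ i → does (toℕ (f i) <? c)) ∣ ≤ c
injective⇒∣f<c∣≤c f f-inj zero = ≤-reflexive (∅⇒∣P∣≡0 _ λ i → dec-false (toℕ (f i) <? 0) λ ())
injective⇒∣f<c∣≤c f f-inj (suc c) = begin
  ∣ below[1+c] ∣       ≤⟨ P⊆Q⇒∣P∣≤∣Q∣ {P = below[1+c]} split ⟩
  ∣ below[c] ∪ at[c] ∣ ≤⟨ ∣P∪Q∣≤∣P∣+∣Q∣ below[c] at[c] ⟩
  ∣ below[c] ∣ + ∣ at[c] ∣ ≤⟨ +-mono-≤ (injective⇒∣f<c∣≤c f f-inj c) (subsingleton⇒∣P∣≤1 at[c] at-unique) ⟩
  c + 1                ≡⟨ +-comm c 1 ⟩
  suc c                ∎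
  where
  open ≤-Reasoning
  below[1+c] below[c] at[c] : _ → Bool
  below[1+c] i = does (toℕ (f i) <? suc c)
  below[c] i = does (toℕ (f i) <? c)
  at[c] i = does (toℕ (f i) ≟ c)
  split : below[1+c] ⊆ (below[c] ∪ at[c])
  split {i} h with m≤n⇒m<n∨m≡n (s≤s⁻¹ (witness (toℕ (f i) <? suc c) h))
  ... | inj₁ fi<c = ∪-introˡ below[c] at[c] (dec-true (toℕ (f i) <? c) fi<c)
  ... | inj₂ fi≡c = ∪-introʳ below[c] at[c] (dec-true (toℕ (f i) ≟ c) fi≡c)
  at-unique : ∀ {i j} → at[c] i ≡ true → at[c] j ≡ true → i ≡ j
  at-unique {i} {j} fi≡c fj≡c =
    f-inj (toℕ-injective (trans (witness (toℕ (f i) ≟ c) fi≡c) (sym (witness (toℕ (f j) ≟ c) fj≡c))))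

-- Injective maps and permutations of Fin n

injective⇒surjective : {f : Fin n → Fin n} → (∀ {i j} → f i ≡ f j → i ≡ j) → ∀ j → ∃ λ i → f i ≡ j
injective⇒surjective {n} {f} f-inj j with any? (λ i → f i ≟ᶠ j)
... | yes found = found
injective⇒surjective {suc n} {f} f-inj j | no ∄ =
  contradiction (injective⇒≤ g-inj) (<-irrefl refl)
  where
  g : Fin (suc n) → Fin n
  g i = punchOut (λ j≡fi → ∄ (i , sym j≡fi))
  g-inj : ∀ {i i′} → g i ≡ g i′ → i ≡ i′
  g-inj {i} {i′} = f-inj ∘ punchOut-injective {i = j} (λ e → ∄ (i , sym e)) (λ e → ∄ (i′ , sym e))

injective⇒permutation : (f : Fin n → Fin n) → (∀ {i j} → f i ≡ f j → i ≡ j) →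
                         ∃ λ (π : Permutation′ n) → ∀ i → π ⟨$⟩ʳ i ≡ f i
injective⇒permutation f f-inj =
  permutation f (proj₁ ∘ surj) (proj₂ ∘ surj) (λ i → f-inj (proj₂ (surj (f i)))) , λ _ → refl
  where surj = injective⇒surjective f-inj

insert-cong : ∀ (j : Fin (suc n)) {π ρ : Permutation′ n} → π ≈ ρ → insert zero j π ≈ insert zero j ρ
insert-cong j π≈ρ zero    = refl
insert-cong j {π} {ρ} π≈ρ (suc k) = begin
  insert zero j π ⟨$⟩ʳ suc k ≡⟨ insert-punchIn zero j π k ⟩
  punchIn j (π ⟨$⟩ʳ k)       ≡⟨ cong (punchIn j) (π≈ρ k) ⟩
  punchIn j (ρ ⟨$⟩ʳ k)       ≡⟨ insert-punchIn zero j ρ k ⟨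
  insert zero j ρ ⟨$⟩ʳ suc k ∎
  where open ≡-Reasoning

-- Every permutation of Fin (suc n) is insert zero j ρ for some j and ρ.
anyPermutation? : {Q : Permutation′ n → Set} → (∀ {π ρ} → π ≈ ρ → Q π → Q ρ) →
                  (∀ π → Dec (Q π)) → Dec (∃ Q)
anyPermutation? {zero} resp Q? = Dec.map′ (idₚ ,_) (λ (π , q) → resp (λ ()) q) (Q? idₚ)
anyPermutation? {suc n} resp Q? =
  Dec.map′ (λ (j , ρ , q) → insert zero j ρ , q)
           (λ (π , q) → π ⟨$⟩ʳ zero , remove zero π , resp (sym ∘ insert-remove zero π) q)
           (any? λ j → anyPermutation? (resp ∘ insert-cong j) (Q? ∘ insert zero j))

module _ (f : Permutation′ n → ℕ) (f-resp : ∀ {π ρ} → π ≈ ρ → f ρ ≤ f π) where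

  minimum-below : ∀ m π → f π ≤ m → ∃ λ π* → ∀ ρ → f π* ≤ f ρ
  minimum-below zero π fπ≤0 = π , λ ρ → ≤-trans fπ≤0 z≤n
  minimum-below (suc m) π fπ≤1+m with anyPermutation? (λ π≈ρ → ≤-trans (f-resp π≈ρ)) (λ ρ → f ρ ≤? m)
  ... | yes (ρ , fρ≤m) = minimum-below m ρ fρ≤m
  ... | no ∄           = π , λ ρ → ≤-trans fπ≤1+m (≰⇒> λ fρ≤m → ∄ (ρ , fρ≤m))

  minimum : ∃ λ π* → ∀ ρ → f π* ≤ f ρ
  minimum = minimum-below (f idₚ) idₚ ≤-refl

⟨$⟩ʳ-injective : (π : Permutation′ n) → ∀ {i j} → π ⟨$⟩ʳ i ≡ π ⟨$⟩ʳ j → i ≡ j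
⟨$⟩ʳ-injective π {i} {j} πi≡πj = begin
  i                     ≡⟨ inverseˡ π ⟨
  π ⟨$⟩ˡ (π ⟨$⟩ʳ i)     ≡⟨ cong (π ⟨$⟩ˡ_) πi≡πj ⟩
  π ⟨$⟩ˡ (π ⟨$⟩ʳ j)     ≡⟨ inverseˡ π ⟩
  j                     ∎
  where open ≡-Reasoning

-- Numberings sorted by a key

module _ {p : ℕ} (b : Fin p → ℕ) where

  lex : Fin p → ℕ
  lex v = b v * p + toℕ v

  lex-mono : ∀ {x y} → b x < b y → lex x < lex y
  lex-mono {x} {y} bx<by = begin-strict
    b x * p + toℕ x <⟨ +-monoʳ-< (b x * p) (toℕ<n x) ⟩
    b x * p + p     ≡⟨ +-comm (b x * p) p ⟩
    suc (b x) * p   ≤⟨ *-monoˡ-≤ p bx<by ⟩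
    b y * p         ≤⟨ m≤m+n (b y * p) (toℕ y) ⟩
    b y * p + toℕ y ∎
    where open ≤-Reasoning

  lex-≤⇒≤ : ∀ {x y} → lex x ≤ lex y → b x ≤ b y
  lex-≤⇒≤ lx≤ly = ≮⇒≥ λ by<bx → <⇒≱ (lex-mono by<bx) lx≤ly

  lex-injective : ∀ {x y} → lex x ≡ lex y → x ≡ y
  lex-injective {x} {y} lx≡ly with <-cmp (b x) (b y)
  ... | tri< bx<by _ _ = contradiction lx≡ly (<⇒≢ (lex-mono bx<by))
  ... | tri> _ _ by<bx = contradiction (sym lx≡ly) (<⇒≢ (lex-mono by<bx))
  ... | tri≈ _ bx≡by _ =
    toℕ-injective (+-cancelˡ-≡ (b y * p) _ _ (subst (λ c → c * p + toℕ x ≡ lex y) bx≡by lx≡ly))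

module _ {p : ℕ} (K : Fin p → ℕ) (K-injective : ∀ {x y} → K x ≡ K y → x ≡ y) where

  private
    below atMost above : Fin p → Fin p → Bool
    below v w = does (K w <? K v)
    atMost v w = does (K w ≤? K v)
    above v w = does (K v <? K w)

  rank : Fin p → ℕ
  rank v = ∣ below v ∣

  rank<∣atMost∣ : ∀ v → rank v < ∣ atMost v ∣
  rank<∣atMost∣ v = P⊆Q∖⁅i⁆⇒∣P∣<∣Q∣ {P = below v} {atMost v}
    (λ {w} w<v → dec-true (K w ≤? K v) (<⇒≤ (witness (K w <? K v) w<v)))
    (dec-false (K v <? K v) (<-irrefl refl)) (dec-true (K v ≤? K v) ≤-refl)

  ∣atMost∣+∣above∣≤p : ∀ v → ∣ atMost v ∣ + ∣ above v ∣ ≤ p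
  ∣atMost∣+∣above∣≤p v = ≤-trans (Disjoint⇒∣P∣+∣Q∣≤∣P∪Q∣ {P = atMost v} {above v} disjoint) (∣P∣≤n _)
    where
    disjoint : Disjoint (atMost v) (above v)
    disjoint {w} w≤v v<w = <⇒≱ (witness (K v <? K w) v<w) (witness (K w ≤? K v) w≤v)

  rank-mono : ∀ {x y} → K x < K y → rank x < rank y
  rank-mono {x} {y} x<y = P⊆Q∖⁅i⁆⇒∣P∣<∣Q∣ {P = below x} {below y}
    (λ {w} w<x → dec-true (K w <? K y) (<-trans (witness (K w <? K x) w<x) x<y))
    (dec-false (K x <? K x) (<-irrefl refl)) (dec-true (K x <? K y) x<y)

  rank-injective : ∀ {x y} → rank x ≡ rank y → x ≡ y
  rank-injective {x} {y} rx≡ry with <-cmp (K x) (K y)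
  ... | tri< x<y _ _ = contradiction rx≡ry (<⇒≢ (rank-mono x<y))
  ... | tri≈ _ x≡y _ = K-injective x≡y
  ... | tri> _ _ y<x = contradiction (sym rx≡ry) (<⇒≢ (rank-mono y<x))

  rank<p : ∀ v → rank v < p
  rank<p v = <-≤-trans (rank<∣atMost∣ v) (∣P∣≤n _)

  rankᶠ : Fin p → Fin p
  rankᶠ v = fromℕ< (rank<p v)

  toℕ-rankᶠ : ∀ v → toℕ (rankᶠ v) ≡ rank v
  toℕ-rankᶠ v = toℕ-fromℕ< (rank<p v)

  rankᶠ-injective : ∀ {x y} → rankᶠ x ≡ rankᶠ y → x ≡ y
  rankᶠ-injective {x} {y} e = rank-injective (trans (sym (toℕ-rankᶠ x)) (trans (cong toℕ e) (toℕ-rankᶠ y)))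

  -- Opaque: later goals need only the two bounds, and unfolding the permutation is very costly.
  opaque
    numbering-by-key : ∃ λ (π : Permutation′ p) → ∀ v →
      suc (toℕ (π ⟨$⟩ʳ v)) ≤ ∣ (λ w → does (K w ≤? K v)) ∣ ×
      suc (toℕ (π ⟨$⟩ʳ v)) + ∣ (λ w → does (K v <? K w)) ∣ ≤ p
    numbering-by-key = π , λ v →
      subst (λ l → suc l ≤ ∣ atMost v ∣) (sym (toℕ-π v)) (rank<∣atMost∣ v) ,
      subst (λ l → suc l + ∣ above v ∣ ≤ p) (sym (toℕ-π v))
            (≤-trans (+-monoˡ-≤ _ (rank<∣atMost∣ v)) (∣atMost∣+∣above∣≤p v))
      where
      numbering : ∃ λ (π : Permutation′ p) → ∀ v → π ⟨$⟩ʳ v ≡ rankᶠ v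
      numbering = injective⇒permutation rankᶠ rankᶠ-injective
      π : Permutation′ p
      π = proj₁ numbering
      toℕ-π : ∀ v → toℕ (π ⟨$⟩ʳ v) ≡ rank v
      toℕ-π v = trans (cong toℕ (proj₂ numbering v)) (toℕ-rankᶠ v)

-- Prefix sums of the sequence y_j

slack-step : ∀ L H m d s → + L ℤ.< + H ℤ.+ ((+ m ℤ.+ + 1 ℤ.- + d) ℤ.+ s) → + (L + d) ℤ.< + (H + (m + 1)) ℤ.+ s
slack-step L H m d s h = subst (+ (L + d) ℤ.<_) (identity (+ H) (+ m) (+ 1) (+ d) s) (ℤ.+-monoˡ-< (+ d) h)
  where
  identity : ∀ H m one d s → H ℤ.+ ((m ℤ.+ one ℤ.- d) ℤ.+ s) ℤ.+ d ≡ H ℤ.+ (m ℤ.+ one) ℤ.+ s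
  identity = solve-∀

slack-head : ∀ L H m d → + L ℤ.< + H ℤ.+ ((+ m ℤ.+ + 1 ℤ.- + d) ℤ.+ + 0) → L + d ≤ H + m
slack-head L H m d h = s≤s⁻¹ (subst (suc (L + d) ≤_) H+[m+1]≡1+H+m
  (ℤ.drop‿+<+ (subst (+ (L + d) ℤ.<_) (ℤ.+-identityʳ _) (slack-step L H m d (+ 0) h))))
  where
  H+[m+1]≡1+H+m : H + (m + 1) ≡ suc (H + m)
  H+[m+1]≡1+H+m = trans (sym (+-assoc H m 1)) (+-comm (H + m) 1)

prefixSums-positive : ∀ a c t → + 0 ℤ.< a ℤ.+ c → ZNonneg (c ∷ t) →
                      ∀ k → 1 ≤ k → k ≤ length (c ∷ t) → + 0 ℤ.< a ℤ.+ sumℤ (take k (c ∷ t))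
prefixSums-positive a c t a+c>0 z (suc k) _ k≤ =
  subst (+ 0 ℤ.<_) (ℤ.+-assoc a c _) (ℤ.+-mono-<-≤ a+c>0 (tail-nonneg k (s≤s⁻¹ k≤)))
  where
  tail-nonneg : ∀ k → k ≤ length t → + 0 ℤ.≤ sumℤ (take k t)
  tail-nonneg zero    _  = ℤ.≤-refl
  tail-nonneg (suc k) k≤ = z (suc k) (s≤s z≤n) k≤

head-positive : ∀ m d → + 0 ℤ.< + d ℤ.+ (+ m ℤ.+ + 1 ℤ.- + d)
head-positive m d = subst (+ 0 ℤ.<_) (sym (identity (+ d) (+ m ℤ.+ + 1))) (ℤ.+<+ (m≤n+m 1 m))
  where
  identity : ∀ d m+1 → d ℤ.+ (m+1 ℤ.- d) ≡ m+1
  identity = solve-∀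

-- Numberings of a graph and the lower bound p + δ(G)

module _ {p : ℕ} (G : Graph p) where

  count≡∣∣ : (P : Fin p → Bool) → count G P ≡ ∣ P ∣
  count≡∣∣ P = foldr-count-tabulate P id

  maxOver-upperBound : (f : Fin p → ℕ) (x : Fin p) → f x ≤ maxOver G f
  maxOver-upperBound f x = foldr-⊔-upperBound f (∈-allFin x)

  maxOver-least : (f : Fin p → ℕ) {b : ℕ} → (∀ x → f x ≤ b) → maxOver G f ≤ b
  maxOver-least f = foldr-⊔-least f (allFin p)

  δ≤deg : ∀ v → δ G ≤ deg G v
  δ≤deg v = foldr-⊓-lowerBound (deg G) (∈-allFin v)

  strf-edge : ∀ π {u v} → adj G u v ≡ true → lab G π u + lab G π v ≤ strf G π
  strf-edge π {u} {v} uv = ≤-trans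
    (subst (λ b → (if b then lab G π u + lab G π v else 0) ≤ row u) uv (maxOver-upperBound (cell u) v))
    (maxOver-upperBound row u)
    where
    cell : Fin p → Fin p → ℕ
    cell u v = if adj G u v then lab G π u + lab G π v else 0
    row : Fin p → ℕ
    row u = maxOver G (cell u)

  strf-least : ∀ π {b} → (∀ u v → adj G u v ≡ true → lab G π u + lab G π v ≤ b) → strf G π ≤ b
  strf-least π {b} edge≤b = maxOver-least _ λ u → maxOver-least _ λ v → cell u v
    where
    cell : ∀ u v → (if adj G u v then lab G π u + lab G π v else 0) ≤ b
    cell u v with adj G u v in uv
    ... | true  = edge≤b u v uv
    ... | false = z≤n

  strf-resp-≈ : ∀ {π ρ} → π ≈ ρ → strf G ρ ≤ strf G π
  strf-resp-≈ {π} {ρ} π≈ρ = strf-least ρ λ u v uv →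
    subst₂ (λ a b → suc (toℕ a) + suc (toℕ b) ≤ strf G π) (π≈ρ u) (π≈ρ v) (strf-edge π uv)

  str-exists : ∃ λ k → IsStr G k
  str-exists with π , minimal ← minimum (strf G) (λ {π} {ρ} → strf-resp-≈ {π} {ρ}) = strf G π , (π , refl) , minimal

  neighbour-label≥deg : ∀ π v → 1 ≤ deg G v → ∃ λ w → adj G v w ≡ true × deg G v ≤ lab G π w
  neighbour-label≥deg π v deg≥1
    with any? (λ w → (adj G v w Bool.≟ true) ×-dec (deg G v ≤? lab G π w))
  ... | yes found = found
  ... | no ∄ = contradiction deg≤pred[deg] (≰pred deg≥1)
    where
    ≰pred : ∀ {n} → 1 ≤ n → ¬ n ≤ pred n
    ≰pred (s≤s _) = 1+n≰n
    labels-small : adj G v ⊆ (λ w → does (toℕ (π ⟨$⟩ʳ w) <? pred (deg G v)))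
    labels-small {w} vw = dec-true (_ <? _) (<⇒≤pred (≰⇒> λ deg≤lab → ∄ (w , vw , deg≤lab)))
    deg≤pred[deg] : deg G v ≤ pred (deg G v)
    deg≤pred[deg] = begin
      deg G v     ≡⟨ count≡∣∣ (adj G v) ⟩
      ∣ adj G v ∣ ≤⟨ P⊆Q⇒∣P∣≤∣Q∣ {P = adj G v} labels-small ⟩
      _           ≤⟨ injective⇒∣f<c∣≤c (π ⟨$⟩ʳ_) (⟨$⟩ʳ-injective π) _ ⟩
      pred (deg G v) ∎
      where open ≤-Reasoning

  lab+deg≤strf : ∀ π v → 1 ≤ deg G v → lab G π v + deg G v ≤ strf G π
  lab+deg≤strf π v deg≥1 with w , vw , deg≤lab ← neighbour-label≥deg π v deg≥1 =
    ≤-trans (+-monoʳ-≤ (lab G π v) deg≤lab) (strf-edge π vw)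

strf≥p+δ : ∀ {p} (G : Graph p) → 1 ≤ δ G → ∀ π → p + δ G ≤ strf G π
strf≥p+δ {zero}  G () π
strf≥p+δ {suc p} G δ≥1 π = begin
  suc p + δ G           ≤⟨ +-monoʳ-≤ (suc p) (δ≤deg G v) ⟩
  suc p + deg G v       ≡⟨ cong (_+ deg G v) lab[v]≡1+p ⟨
  lab G π v + deg G v   ≤⟨ lab+deg≤strf G π v (≤-trans δ≥1 (δ≤deg G v)) ⟩
  strf G π              ∎
  where
  open ≤-Reasoning
  v : Fin (suc p)
  v = π ⟨$⟩ˡ fromℕ p
  lab[v]≡1+p : lab G π v ≡ suc p
  lab[v]≡1+p = cong suc (trans (cong toℕ (inverseʳ π)) (toℕ-fromℕ p))

-- The numbering along a d-sequence

module _ {p : ℕ} (G : Graph p) where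

  private
    variable
      S : VSet G
      i : ℕ
      u v w : Fin p

  degIn≡∣∣ : degIn G S v ≡ ∣ (λ w → S w ∧ adj G v w) ∣
  degIn≡∣∣ = count≡∣∣ G _

  neighbour⇒degIn≢0 : S w ≡ true → adj G v w ≡ true → (degIn G S v ≡ᵇ 0) ≡ false
  neighbour⇒degIn≢0 {S} {w} {v} Sw vw =
    positive⇒≢ᵇ0 (subst (0 <_) (sym degIn≡∣∣) (∈⇒0<∣P∣ (λ w → S w ∧ adj G v w) {w} (cong₂ _∧_ Sw vw)))

  edge⇒¬isolated : S v ≡ true → S w ≡ true → adj G v w ≡ true → isIso G S v ≡ false
  edge⇒¬isolated Sv Sw vw = cong₂ _∧_ Sv (neighbour⇒degIn≢0 Sw vw)

  edge⇒nonIsolated : S v ≡ true → S w ≡ true → adj G v w ≡ true → isNonIso G S v ≡ true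
  edge⇒nonIsolated Sv Sw vw = cong₂ (λ a b → a ∧ not b) Sv (neighbour⇒degIn≢0 Sw vw)

  isolated⇒∈ : isIso G S v ≡ true → S v ≡ true
  isolated⇒∈ iso = Bool.∧-conicalˡ _ _ iso

  isolated⇒¬edge : isIso G S v ≡ true → S w ≡ true → adj G v w ≢ true
  isolated⇒¬edge iso Sw vw with () ← trans (sym iso) (edge⇒¬isolated (isolated⇒∈ iso) Sw vw)

  next-intro : S v ≡ true → (degIn G S v ≡ᵇ 0) ≡ false → u ≢ v → adj G u v ≡ false → next G S u v ≡ true
  next-intro {S} {v} {u} Sv d≢0 u≢v uv = begin
    S v ∧ not (degIn G S v ≡ᵇ 0) ∧ not (does (u ≟ᶠ v)) ∧ not (adj G u v)
      ≡⟨ cong₂ (λ s d → s ∧ not d ∧ not (does (u ≟ᶠ v)) ∧ not (adj G u v)) Sv d≢0 ⟩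
    not (does (u ≟ᶠ v)) ∧ not (adj G u v)
      ≡⟨ cong₂ (λ e a → not e ∧ not a) (dec-false (u ≟ᶠ v) u≢v) uv ⟩
    true ∎
    where open ≡-Reasoning

  next-elim : next G S u v ≡ true → S v ≡ true × isIso G S v ≡ false × u ≢ v × adj G u v ≡ false
  next-elim {S} {u} {v} h = Sv , cong₂ _∧_ Sv (Bool.not-injective d≢0) , u≢v , Bool.not-injective ¬uv
    where
    d = degIn G S v ≡ᵇ 0
    e = does (u ≟ᶠ v)
    Sv = Bool.∧-conicalˡ (S v) _ h
    d≢0 = Bool.∧-conicalˡ (not d) _ (Bool.∧-conicalʳ (S v) _ h)
    rest = Bool.∧-conicalʳ (not d) _ (Bool.∧-conicalʳ (S v) _ h)
    ¬e = Bool.∧-conicalˡ (not e) _ rest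
    ¬uv = Bool.∧-conicalʳ (not e) _ rest
    u≢v : u ≢ v
    u≢v u≡v with () ← trans (sym ¬e) (cong not (dec-true (u ≟ᶠ v) u≡v))

  data Part (S : VSet G) (u v : Fin p) : Set where
    neighbour : adj G u v ≡ true → Part S u v
    isolated  : isIso G S v ≡ true → Part S u v
    centre    : u ≡ v → Part S u v
    remaining : next G S u v ≡ true → Part S u v

  part : ∀ u → S v ≡ true → Part S u v
  part {S} {v} u Sv with adj G u v in uv
  ... | true = neighbour uv
  ... | false with degIn G S v ≡ᵇ 0 in d
  ... | true = isolated (cong₂ _∧_ Sv d)
  ... | false with u ≟ᶠ v
  ... | yes u≡v = centre u≡v
  ... | no u≢v = remaining (next-intro Sv d u≢v uv)

  -- For D started at step index i, the neighbours of the centre form block i, the centre block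
  -- top D i and the isolated vertices block top D i + 1; all blocks of the rest of D lie
  -- strictly between i and top D i.
  top : DSeq G S → ℕ → ℕ
  top (stop _) i = i
  top (step _ _ _ _ D′) i = 2 + top D′ (suc i)

  block : DSeq G S → ℕ → Fin p → ℕ
  block {S} D@(stop _) i v = if isIso G S v then suc (top D i) else i
  block {S} D@(step _ u _ _ D′) i v =
    if adj G u v then i else
    if isIso G S v then suc (top D i) else
    if does (u ≟ᶠ v) then top D i else
    block D′ (suc i) v

  key : DSeq G S → ℕ → Fin p → ℕ
  key D i = lex (block D i)

  i≤top : (D : DSeq G S) → i ≤ top D i
  i≤top (stop _) = ≤-refl
  i≤top (step _ _ _ _ D′) = ≤-trans (n≤1+n _) (≤-trans (i≤top D′) (m≤n+m _ 2))

  module Step (nt : ¬ Terminal G S) (u : Fin p) (Su : S u ≡ true) (du : 1 ≤ degIn G S u)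
              (D′ : DSeq G (next G S u)) where

    D = step nt u Su du D′

    i<top : i < top D i
    i<top = ≤-trans (i≤top D′) (m≤n+m _ 2)

    block-neighbour : adj G u v ≡ true → block D i v ≡ i
    block-neighbour uv rewrite uv = refl

    block-centre : block D i u ≡ top D i
    block-centre rewrite Graph.irrefl G u | cong₂ _∧_ Su (positive⇒≢ᵇ0 du) | dec-true (u ≟ᶠ u) refl = refl

    block-isolated-step : isIso G S v ≡ true → block D i v ≡ suc (top D i)
    block-isolated-step {v} iso with adj G u v in uv
    ... | true = contradiction (trans (Graph.sym G v u) uv) (isolated⇒¬edge iso Su)
    ... | false rewrite iso = refl

    block-remaining : next G S u v ≡ true → block D i v ≡ block D′ (suc i) v
    block-remaining {v} h with _ , ¬iso , u≢v , ¬uv ← next-elim {S = S} h =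
      trans (if-false ¬uv) (trans (if-false ¬iso) (if-false (dec-false (u ≟ᶠ v) u≢v)))

  block-isolated : (D : DSeq G S) → isIso G S v ≡ true → block D i v ≡ suc (top D i)
  block-isolated (stop _) iso rewrite iso = refl
  block-isolated (step nt u Su du D′) iso = Step.block-isolated-step nt u Su du D′ iso

  block-nonIsolated-stop : {t : Terminal G S} → isIso G S v ≡ false → block (stop t) i v ≡ i
  block-nonIsolated-stop ¬iso rewrite ¬iso = refl

  i≤block : (D : DSeq G S) → S v ≡ true → i ≤ block D i v
  i≤block {S} {v} {i} (stop t) Sv with isIso G S v in iso
  ... | true  = n≤1+n i
  ... | false = ≤-refl
  i≤block {S} {v} {i} (step nt u Su du D′) Sv = by-part (part u Sv)
    where
    open Step nt u Su du D′
    by-part : Part S u v → i ≤ block D i v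
    by-part (neighbour uv) = ≤-reflexive (sym (block-neighbour uv))
    by-part (isolated iso) = ≤-trans (i≤top D) (≤-trans (n≤1+n _) (≤-reflexive (sym (block-isolated D iso))))
    by-part (centre refl)  = ≤-trans (i≤top D) (≤-reflexive (sym block-centre))
    by-part (remaining h)  = ≤-trans (n≤1+n i) (≤-trans (i≤block D′ h) (≤-reflexive (sym (block-remaining h))))

  block≤1+top : (D : DSeq G S) → S v ≡ true → block D i v ≤ suc (top D i)
  block≤1+top {S} {v} {i} (stop t) Sv with isIso G S v in iso
  ... | true  = ≤-refl
  ... | false = n≤1+n i
  block≤1+top {S} {v} {i} (step nt u Su du D′) Sv = by-part (part u Sv)
    where
    open Step nt u Su du D′
    by-part : Part S u v → block D i v ≤ suc (top D i)
    by-part (neighbour uv) = ≤-trans (≤-reflexive (block-neighbour uv)) (≤-trans (i≤top D) (n≤1+n _))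
    by-part (isolated iso) = ≤-reflexive (block-isolated D iso)
    by-part (centre refl)  = ≤-trans (≤-reflexive block-centre) (n≤1+n _)
    by-part (remaining h)  = ≤-trans (≤-reflexive (block-remaining h))
                               (≤-trans (block≤1+top D′ h) (s≤s (m≤n+m _ 2)))

  block≤top : (D : DSeq G S) → S v ≡ true → isIso G S v ≡ false → block D i v ≤ top D i
  block≤top {S} (stop t) Sv ¬iso = ≤-reflexive (block-nonIsolated-stop {t = t} ¬iso)
  block≤top {S} {v} {i} (step nt u Su du D′) Sv ¬iso = by-part (part u Sv)
    where
    open Step nt u Su du D′
    by-part : Part S u v → block D i v ≤ top D i
    by-part (neighbour uv) = ≤-trans (≤-reflexive (block-neighbour uv)) (i≤top D)
    by-part (isolated iso) with () ← trans (sym iso) ¬iso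
    by-part (centre refl)  = ≤-reflexive block-centre
    by-part (remaining h)  = ≤-trans (≤-reflexive (block-remaining h)) (≤-trans (block≤1+top D′ h) (n≤1+n _))

  below above : VSet G → (Fin p → ℕ) → Fin p → Fin p → Bool
  below S k v w = S w ∧ does (k w ≤? k v)
  above S k v w = S w ∧ does (k v <? k w)

  below-intro : ∀ S k → S w ≡ true → k w ≤ k v → below S k v w ≡ true
  below-intro S k Sw kw≤kv = cong₂ _∧_ Sw (dec-true (_ ≤? _) kw≤kv)

  below-elim : ∀ S k → below S k v w ≡ true → S w ≡ true × k w ≤ k v
  below-elim {w = w} S k h = Bool.∧-conicalˡ (S w) _ h , witness (_ ≤? _) (Bool.∧-conicalʳ (S w) _ h)

  above-intro : ∀ S k → S w ≡ true → k v < k w → above S k v w ≡ true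
  above-intro S k Sw kv<kw = cong₂ _∧_ Sw (dec-true (_ <? _) kv<kw)

  above-elim : ∀ S k → above S k v w ≡ true → S w ≡ true × k v < k w
  above-elim {w = w} S k h = Bool.∧-conicalˡ (S w) _ h , witness (_ <? _) (Bool.∧-conicalʳ (S w) _ h)

  isolated-or-nonIsolated : S v ≡ true → isIso G S v ≡ true ⊎ isNonIso G S v ≡ true
  isolated-or-nonIsolated {S} {v} Sv with degIn G S v ≡ᵇ 0
  ... | true  = inj₁ (cong (_∧ true) Sv)
  ... | false = inj₂ (cong (_∧ true) Sv)

  next-centre : next G S u u ≡ false
  next-centre {S} {u} with next G S u u in h
  ... | true  = contradiction refl (proj₁ (proj₂ (proj₂ (next-elim {S = S} h))))
  ... | false = refl

  nIso≤∣above∣ : (D : DSeq G S) → S w ≡ true → isIso G S w ≡ false → nIso G S ≤ ∣ above S (key D i) w ∣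
  nIso≤∣above∣ {S} {w} {i} D Sw ¬iso =
    ≤-trans (≤-reflexive (count≡∣∣ G (isIso G S))) (P⊆Q⇒∣P∣≤∣Q∣ {P = isIso G S} iso⊆above)
    where
    iso⊆above : isIso G S ⊆ above S (key D i) w
    iso⊆above iso = above-intro S (key D i) (isolated⇒∈ iso) (lex-mono (block D i)
      (≤-trans (s≤s (block≤top D Sw ¬iso)) (≤-reflexive (sym (block-isolated D iso)))))

  module StepCount (nt : ¬ Terminal G S) (u : Fin p) (Su : S u ≡ true) (du : 1 ≤ degIn G S u)
                   (D′ : DSeq G (next G S u)) where

    open Step nt u Su du D′

    key-remaining : next G S u v ≡ true → key D i v ≡ key D′ (suc i) v
    key-remaining {v} h = cong (λ b → b * p + toℕ v) (block-remaining h)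

    i<block-remaining : next G S u v ≡ true → i < block D i v
    i<block-remaining h = ≤-trans (i≤block D′ h) (≤-reflexive (sym (block-remaining h)))

    block-remaining<top : next G S u v ≡ true → block D i v < top D i
    block-remaining<top h = s≤s (≤-trans (≤-reflexive (block-remaining h)) (block≤1+top D′ h))

    ∣below∣≤degIn : adj G u v ≡ true → ∣ below S (key D i) v ∣ ≤ degIn G S u
    ∣below∣≤degIn {v} {i} uv =
      ≤-trans (P⊆Q⇒∣P∣≤∣Q∣ {P = below S (key D i) v} below⊆neighbours) (≤-reflexive (sym degIn≡∣∣))
      where
      below⊆neighbours : below S (key D i) v ⊆ (λ z → S z ∧ adj G u z)
      below⊆neighbours {z} h = by-part (part u Sz)
        where
        Sz = proj₁ (below-elim S (key D i) h)
        ¬i<bz : ¬ i < block D i z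
        ¬i<bz = ≤⇒≯ (≤-trans (lex-≤⇒≤ (block D i) (proj₂ (below-elim S (key D i) h)))
                             (≤-reflexive (block-neighbour uv)))
        by-part : Part S u z → S z ∧ adj G u z ≡ true
        by-part (neighbour uz) = cong₂ _∧_ Sz uz
        by-part (isolated iso) = contradiction (≤-trans (s≤s (i≤top D)) (≤-reflexive (sym (block-isolated D iso)))) ¬i<bz
        by-part (centre refl)  = contradiction (≤-trans i<top (≤-reflexive (sym block-centre))) ¬i<bz
        by-part (remaining hz) = contradiction (i<block-remaining hz) ¬i<bz

    ∣below∣-remaining : next G S u v ≡ true →
      ∣ below S (key D i) v ∣ ≤ degIn G S u + ∣ below (next G S u) (key D′ (suc i)) v ∣
    ∣below∣-remaining {v} {i} hv = begin
      ∣ below S (key D i) v ∣     ≤⟨ P⊆Q⇒∣P∣≤∣Q∣ {P = below S (key D i) v} below⊆ ⟩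
      ∣ neighbours ∪ below′ ∣     ≤⟨ ∣P∪Q∣≤∣P∣+∣Q∣ neighbours below′ ⟩
      ∣ neighbours ∣ + ∣ below′ ∣ ≡⟨ cong (_+ ∣ below′ ∣) degIn≡∣∣ ⟨
      degIn G S u + ∣ below′ ∣    ∎
      where
      open ≤-Reasoning
      neighbours below′ : Fin p → Bool
      neighbours z = S z ∧ adj G u z
      below′ = below (next G S u) (key D′ (suc i)) v
      below⊆ : below S (key D i) v ⊆ (neighbours ∪ below′)
      below⊆ {z} h = by-part (part u Sz)
        where
        Sz = proj₁ (below-elim S (key D i) h)
        kz≤kv = proj₂ (below-elim S (key D i) h)
        ¬top≤bz : ¬ top D i ≤ block D i z
        ¬top≤bz top≤bz = <⇒≱ (block-remaining<top hv) (≤-trans top≤bz (lex-≤⇒≤ (block D i) kz≤kv))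
        by-part : Part S u z → (neighbours ∪ below′) z ≡ true
        by-part (neighbour uz) = ∪-introˡ neighbours below′ (cong₂ _∧_ Sz uz)
        by-part (isolated iso) = contradiction (≤-trans (n≤1+n _) (≤-reflexive (sym (block-isolated D iso)))) ¬top≤bz
        by-part (centre refl)  = contradiction (≤-reflexive (sym block-centre)) ¬top≤bz
        by-part (remaining hz) = ∪-introʳ neighbours below′
          (below-intro (next G S u) (key D′ (suc i)) hz (subst₂ _≤_ (key-remaining hz) (key-remaining hv) kz≤kv))

    ∣above∣-remaining : next G S u w ≡ true →
      nIso G S + 1 + ∣ above (next G S u) (key D′ (suc i)) w ∣ ≤ ∣ above S (key D i) w ∣
    ∣above∣-remaining {w} {i} hw = begin
      nIso G S + 1 + ∣ above′ ∣        ≡⟨ cong (_+ ∣ above′ ∣) (trans (cong (_+ 1) (count≡∣∣ G _)) (+-comm _ 1)) ⟩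
      suc (∣ isIso G S ∣ + ∣ above′ ∣) ≤⟨ s≤s (Disjoint⇒∣P∣+∣Q∣≤∣P∪Q∣ {P = isIso G S} {above′} disjoint) ⟩
      suc ∣ isIso G S ∪ above′ ∣       ≤⟨ P⊆Q∖⁅i⁆⇒∣P∣<∣Q∣ {P = isIso G S ∪ above′} ⊆above u∉ u∈ ⟩
      ∣ above S (key D i) w ∣          ∎
      where
      open ≤-Reasoning
      above′ : Fin p → Bool
      above′ = above (next G S u) (key D′ (suc i)) w
      bw<top : block D i w < top D i
      bw<top = block-remaining<top hw
      disjoint : Disjoint (isIso G S) above′
      disjoint iso h with hz , _ ← above-elim (next G S u) (key D′ (suc i)) h
        with () ← trans (sym iso) (proj₁ (proj₂ (next-elim {S = S} hz)))
      ⊆above : (isIso G S ∪ above′) ⊆ above S (key D i) w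
      ⊆above h with ∪-elim (isIso G S) above′ h
      ... | inj₁ iso = above-intro S (key D i) (isolated⇒∈ iso)
          (lex-mono (block D i) (≤-trans bw<top (≤-trans (n≤1+n _) (≤-reflexive (sym (block-isolated D iso))))))
      ... | inj₂ h′ with hz , kw<kz ← above-elim (next G S u) (key D′ (suc i)) h′ =
        above-intro S (key D i) (proj₁ (next-elim {S = S} hz))
                    (subst₂ _<_ (sym (key-remaining hw)) (sym (key-remaining hz)) kw<kz)
      u∉ : (isIso G S ∪ above′) u ≡ false
      u∉ = cong₂ _∨_ (cong₂ _∧_ Su (positive⇒≢ᵇ0 du))
                     (cong (_∧ does (key D′ (suc i) w <? key D′ (suc i) u)) (next-centre {S = S}))
      u∈ : above S (key D i) w u ≡ true
      u∈ = above-intro S (key D i) Su (lex-mono (block D i) (≤-trans bw<top (≤-reflexive (sym block-centre))))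

  -- L counts the low labels handed out before D, and H the high ones plus d_G; Fits asks for
  -- L_j + d_j ≤ H_j + m_j at every step j.
  Fits : DSeq G S → ℕ → ℕ → Set
  Fits {S} D@(stop _) L H = L + dHead G D ≤ H + nIso G S
  Fits {S} D@(step _ _ _ _ D′) L H = L + dHead G D ≤ H + nIso G S × Fits D′ (L + dHead G D) (H + (nIso G S + 1))

  edges-fit : (D : DSeq G S) (i : ℕ) {L H : ℕ} → Fits D L H →
              S v ≡ true → S w ≡ true → adj G v w ≡ true → key D i v < key D i w →
              L + ∣ below S (key D i) v ∣ ≤ H + ∣ above S (key D i) w ∣
  edges-fit {S} {v} {w} D@(stop t) i {L} {H} fits Sv Sw vw kv<kw = begin
    L + ∣ below S (key D i) v ∣  ≤⟨ +-monoʳ-≤ L (m+n≤o⇒m≤o∸n _ (≤-trans (≤-reflexive (+-comm _ 1)) below<nonIso)) ⟩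
    L + (nNonIso G S ∸ 1)        ≤⟨ fits ⟩
    H + nIso G S                 ≤⟨ +-monoʳ-≤ H (nIso≤∣above∣ D Sw (edge⇒¬isolated Sw Sv wv)) ⟩
    H + ∣ above S (key D i) w ∣  ∎
    where
    open ≤-Reasoning
    wv = trans (Graph.sym G w v) vw
    bv≡i : block D i v ≡ i
    bv≡i = block-nonIsolated-stop {t = t} (edge⇒¬isolated Sv Sw vw)
    below⊆nonIso : below S (key D i) v ⊆ isNonIso G S
    below⊆nonIso h with Sz , kz≤kv ← below-elim S (key D i) h with isolated-or-nonIsolated Sz
    ... | inj₁ iso = contradiction (≤-trans (lex-≤⇒≤ (block D i) kz≤kv) (≤-reflexive bv≡i))
                                   (<⇒≱ (≤-trans (s≤s ≤-refl) (≤-reflexive (sym (block-isolated D iso)))))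
    ... | inj₂ nonIso = nonIso
    below<nonIso : ∣ below S (key D i) v ∣ < nNonIso G S
    below<nonIso = ≤-trans (P⊆Q∖⁅i⁆⇒∣P∣<∣Q∣ {P = below S (key D i) v} {isNonIso G S} {w} below⊆nonIso
                     (cong₂ _∧_ Sw (dec-false (_ ≤? _) (<⇒≱ kv<kw))) (edge⇒nonIsolated Sw Sv wv))
                     (≤-reflexive (sym (count≡∣∣ G _)))
  edges-fit {S} {v} {w} (step nt u Su du D′) i {L} {H} (fits , fits′) Sv Sw vw kv<kw = by-part (part u Sv)
    where
    open Step nt u Su du D′
    open StepCount nt u Su du D′
    open ≤-Reasoning
    wv = trans (Graph.sym G w v) vw
    ¬bw<bv : ¬ block D i w < block D i v
    ¬bw<bv bw<bv = <⇒≱ kv<kw (<⇒≤ (lex-mono (block D i) bw<bv))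
    by-part : Part S u v → L + ∣ below S (key D i) v ∣ ≤ H + ∣ above S (key D i) w ∣
    by-part (neighbour uv) = begin
      L + ∣ below S (key D i) v ∣  ≤⟨ +-monoʳ-≤ L (∣below∣≤degIn uv) ⟩
      L + degIn G S u              ≤⟨ fits ⟩
      H + nIso G S                 ≤⟨ +-monoʳ-≤ H (nIso≤∣above∣ D Sw (edge⇒¬isolated Sw Sv wv)) ⟩
      H + ∣ above S (key D i) w ∣  ∎
    by-part (isolated iso) = contradiction vw (isolated⇒¬edge iso Sw)
    by-part (centre refl)  = contradiction
      (≤-trans (s≤s (≤-reflexive (block-neighbour vw))) (≤-trans i<top (≤-reflexive (sym block-centre))))
      ¬bw<bv
    by-part (remaining hv) = by-part′ (part u Sw)
      where
      by-part′ : Part S u w → L + ∣ below S (key D i) v ∣ ≤ H + ∣ above S (key D i) w ∣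
      by-part′ (neighbour uw) = contradiction
        (≤-trans (s≤s (≤-reflexive (block-neighbour uw))) (i<block-remaining hv))
        ¬bw<bv
      by-part′ (isolated iso) = contradiction wv (isolated⇒¬edge iso Sv)
      by-part′ (centre refl)  with () ← trans (sym wv) (proj₂ (proj₂ (proj₂ (next-elim {S = S} hv))))
      by-part′ (remaining hw) = begin
        L + ∣ below S (key D i) v ∣                          ≤⟨ +-monoʳ-≤ L (∣below∣-remaining hv) ⟩
        L + (degIn G S u + ∣ below S′ (key D′ (suc i)) v ∣)   ≡⟨ +-assoc L _ _ ⟨
        L + degIn G S u + ∣ below S′ (key D′ (suc i)) v ∣     ≤⟨ edges-fit D′ (suc i) fits′ hv hw vw kv<kw′ ⟩
        H + (nIso G S + 1) + ∣ above S′ (key D′ (suc i)) w ∣  ≡⟨ +-assoc H _ _ ⟩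
        H + (nIso G S + 1 + ∣ above S′ (key D′ (suc i)) w ∣)  ≤⟨ +-monoʳ-≤ H (∣above∣-remaining hw) ⟩
        H + ∣ above S (key D i) w ∣                          ∎
        where
        S′ = next G S u
        kv<kw′ : key D′ (suc i) v < key D′ (suc i) w
        kv<kw′ = subst₂ _<_ (key-remaining hv) (key-remaining hw) kv<kw

  fits-from-prefixSums : (D : DSeq G S) (L H : ℕ) →
    (∀ k → 1 ≤ k → k ≤ length (ys G D) → + L ℤ.< + H ℤ.+ sumℤ (take k (ys G D))) → Fits D L H
  fits-from-prefixSums {S} (stop _) L H ok = slack-head L H (nIso G S) _ (ok 1 ≤-refl ≤-refl)
  fits-from-prefixSums {S} (step _ u _ _ D′) L H ok =
    slack-head L H (nIso G S) (degIn G S u) (ok 1 ≤-refl (s≤s z≤n)) ,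
    fits-from-prefixSums D′ (L + degIn G S u) (H + (nIso G S + 1))
      λ k _ k≤ → slack-step L H (nIso G S) (degIn G S u) _ (ok (suc k) (s≤s z≤n) (s≤s k≤))

  fits-top : (D : DSeq G S) → ZNonneg (ys G D) → Fits D 0 (dHead G D)
  fits-top {S} D@(stop _) z = fits-from-prefixSums D 0 d (prefixSums-positive (+ d) (y G m d) [] (head-positive m d) z)
    where
    m = nIso G S
    d = dHead G D
  fits-top {S} D@(step _ _ _ _ D′) z =
    fits-from-prefixSums D 0 d (prefixSums-positive (+ d) (y G m d) (ys G D′) (head-positive m d) z)
    where
    m = nIso G S
    d = dHead G D

  numbering-from-dSequence : (D : DSeq G (full G)) → ZNonneg (ys G D) → ∃ λ π → strf G π ≤ p + dG G D
  numbering-from-dSequence D z = π , strf-least G π edge-bound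
    where
    K = key D 0
    numbering = numbering-by-key K (lex-injective (block D 0))
    π = proj₁ numbering
    bounds = proj₂ numbering
    fits = fits-top D z
    oriented : ∀ {v w} → adj G v w ≡ true → K v < K w → lab G π v + lab G π w ≤ p + dG G D
    oriented {v} {w} vw kv<kw = begin
      lab G π v + lab G π w              ≤⟨ +-monoˡ-≤ _ (proj₁ (bounds v)) ⟩
      ∣ below (full G) K v ∣ + lab G π w ≤⟨ +-monoˡ-≤ _ (edges-fit D 0 fits refl refl vw kv<kw) ⟩
      dG G D + a + lab G π w             ≡⟨ +-assoc (dG G D) a _ ⟩
      dG G D + (a + lab G π w)           ≡⟨ cong (λ c → dG G D + c) (+-comm a _) ⟩
      dG G D + (lab G π w + a)           ≤⟨ +-monoʳ-≤ (dG G D) (proj₂ (bounds w)) ⟩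
      dG G D + p                         ≡⟨ +-comm (dG G D) p ⟩
      p + dG G D                         ∎
      where
      open ≤-Reasoning
      a = ∣ above (full G) K w ∣
    edge-bound : ∀ v w → adj G v w ≡ true → lab G π v + lab G π w ≤ p + dG G D
    edge-bound v w vw with <-cmp (K v) (K w)
    ... | tri< kv<kw _ _ = oriented vw kv<kw
    ... | tri> _ _ kw<kv =
      ≤-trans (≤-reflexive (+-comm (lab G π v) (lab G π w))) (oriented (trans (Graph.sym G w v) vw) kw<kv)
    ... | tri≈ _ kv≡kw _ with refl ← lex-injective (block D 0) kv≡kw with () ← trans (sym vw) (Graph.irrefl G v)

isStr-intro : ∀ {p} (G : Graph p) {b} π → strf G π ≤ b → (∀ ρ → b ≤ strf G ρ) → IsStr G b
isStr-intro G π strf≤b b≤strf = (π , ≤-antisym strf≤b (b≤strf π)) , b≤strf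

mainTheorem6 : (p : ℕ) (G : Graph p)
    → (∀ v → 1 ≤ deg G v)
    → δ G ≥ 1 → p ∸ 2 ≥ δ G
    → (D : DSeq G (full G))
    → ZNonneg (ys G D)
    → (∃ λ k → IsStr G k × k ≤ p + dG G D)
    × (dG G D ≡ δ G → IsStr G (p + dG G D))
mainTheorem6 p G _ δ≥1 _ D z with π , strf≤ ← numbering-from-dSequence G D z | k , isStr ← str-exists G =
  (k , isStr , ≤-trans (proj₂ isStr π) strf≤) ,
  λ dG≡δ → isStr-intro G π strf≤ λ ρ → subst (λ d → p + d ≤ strf G ρ) (sym dG≡δ) (strf≥p+δ G δ≥1 ρ)
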